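{- Let $G=(V,E)$ be a finite, loopless, connected multi-graph with $V=\{v_1,\dots,v_n\}$ and $E=\{e_1,\dots,e_m\}$, and let $\omega$ be the weight function on $E$ given by $\omega(e_j)=y_j$ for $j\in\{1,\dots,m\}$, where $y_1,\dots,y_m$ are indeterminates. Then $$\prod_{i=1}^{n-1}\ \sum_{e_j\in E_G(v_i)}y_j=\tau(G,\omega)+\sum_{T_0\in \mathrm{NST}_{v_n}(G)}\tau(T_0,\omega)\,F(G-V(T_0),\omega).$$
   Context: $E_G(v)$ is the set of edges of $G$ incident with $v$. For a tree $T$ (a subgraph of $G$), $\tau(T,\omega)=\prod_{e_j\in E(T)}y_j$ if $E(T)\neq\emptyset$, and $\tau(T,\omega)=1$ if $E(T)=\emptyset$. $\tau(G,\omega)=\sum_{T}\tau(T,\omega)$, the sum over all spanning trees $T$ of $G$ (spanning trees are counted as edge sets). $\mathrm{NST}_{v_n}(G)$ is the set of subtrees $T_0$ of $G$ (subgraphs that are trees, distinct edge sets counted separately) with $v_n\in V(T_0)$ and $V(T_0)\neq V$; it includes the single-vertex tree $\{v_n\}$. For $S\subsetneq V$, $G-S$ is the subgraph of $G$ induced by $V\setminus S$. For a multi-graph $H$ whose edges are among $e_1,\dots,e_m$, $F(H,\omega)=\prod_{v\in V(H)}\sum_{e_j\in E_H(v)}y_j$ if $V(H)\neq\emptyset$, and $F(H,\omega)=1$ if $V(H)=\emptyset$, where $E_H(v)$ is the set of edges of $H$ incident with $v$. -}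

module Defs where

open import Level using (Level)
open import Data.Nat using (ℕ; zero; suc)
open import Data.Fin using (Fin; zero; suc; inject₁; fromℕ; _≟_)
open import Data.Fin.Subset using (Subset; _∈_; _∉_; ⊤)
open import Data.Fin.Subset.Properties using (_∈?_)
open import Data.Vec using (Vec; []; _∷_)
open import Data.Bool using (true; false)
open import Data.List using (List; []; _∷_; map; _++_; allFin; filter; foldr; cartesianProduct)
open import Data.Product using (_×_; _,_; proj₁; proj₂; Σ; ∃)
open import Data.Sum using (_⊎_)
open import Relation.Binary.PropositionalEquality using (_≡_; _≢_)
open import Relation.Nullary using (¬_; Dec)
open import Relation.Nullary.Decidable using (_⊎-dec_; _×-dec_; ¬?)
open import Relation.Unary using (Decidable)
open import Algebra.Bundles using (CommutativeRing)

-- Finite multigraphs: vertices v_1..v_n are Fin n, edges e_1..e_m are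
-- Fin m, and edge j has the (unordered) pair of endpoints  ends j.

record MultiGraph (n m : ℕ) : Set where
  field
    ends : Fin m → Fin n × Fin n

module _ {n m : ℕ} (G : MultiGraph n m) where
  open MultiGraph G

  end₁ end₂ : Fin m → Fin n
  end₁ j = proj₁ (ends j)
  end₂ j = proj₂ (ends j)

  Loopless : Set
  Loopless = ∀ j → end₁ j ≢ end₂ j

  Incident : Fin m → Fin n → Set
  Incident j v = end₁ j ≡ v ⊎ end₂ j ≡ v

  incident? : (v : Fin n) → Decidable (λ j → Incident j v)
  incident? v j = (end₁ j ≟ v) ⊎-dec (end₂ j ≟ v)

  Joins : Fin m → Fin n → Fin n → Set
  Joins j u w = (end₁ j ≡ u × end₂ j ≡ w) ⊎ (end₁ j ≡ w × end₂ j ≡ u)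

  data Walk (S : Subset m) : Fin n → Fin n → Set where
    []   : ∀ {u} → Walk S u u
    step : ∀ {u x w} (j : Fin m) → j ∈ S → Joins j u x → Walk S x w → Walk S u w

  Connected : Set
  Connected = ∀ u w → Walk ⊤ u w

  -- a cycle in the edge set S: pairwise distinct edges edge 0..edge len and
  -- pairwise distinct vertices vert 0..vert len, edge i joining vert i and
  -- vert (i+1), with vert (len+1) = vert 0.  (Two parallel edges form a cycle.)
  record Cycle (S : Subset m) : Set where
    field
      len      : ℕ
      edge     : Fin (suc len) → Fin m
      vert     : Fin (suc (suc len)) → Fin n
      closed   : vert (fromℕ (suc len)) ≡ vert zero
      edges-in : ∀ i → edge i ∈ S
      joins    : ∀ i → Joins (edge i) (vert (inject₁ i)) (vert (suc i))
      edge-inj : ∀ i k → edge i ≡ edge k → i ≡ k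
      vert-inj : ∀ i k → vert (inject₁ i) ≡ vert (inject₁ k) → i ≡ k

  IsTree : Subset n → Subset m → Set
  IsTree U S =
      (∃ λ u → u ∈ U)
    × (∀ j → j ∈ S → end₁ j ∈ U × end₂ j ∈ U)
    × (∀ u w → u ∈ U → w ∈ U → Walk S u w)
    × ¬ Cycle S

  IsSpanningTree : Subset m → Set
  IsSpanningTree S = IsTree ⊤ S

  IsNST : Fin n → Subset n × Subset m → Set
  IsNST v (U , S) = IsTree U S × v ∈ U × U ≢ ⊤

allSubsets : ∀ k → List (Subset k)
allSubsets zero    = [] ∷ []
allSubsets (suc k) = map (true ∷_) (allSubsets k) ++ map (false ∷_) (allSubsets k)

module Weighted {c ℓ : Level} (R : CommutativeRing c ℓ) where
  open CommutativeRing R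

  ∑ : List Carrier → Carrier
  ∑ = foldr _+_ 0#

  ∏ : List Carrier → Carrier
  ∏ = foldr _*_ 1#

  module _ {n m : ℕ} (G : MultiGraph n m) (y : Fin m → Carrier) where

    degW : Fin n → Carrier
    degW v = ∑ (map y (filter (incident? G v) (allFin m)))

    τT : Subset m → Carrier
    τT S = ∏ (map y (filter (_∈? S) (allFin m)))

    τG : (∀ S → Dec (IsSpanningTree G S)) → Carrier
    τG dec = ∑ (map τT (filter dec (allSubsets m)))

    F-minus : Subset n → Carrier
    F-minus U = ∏ (map deg' (filter (λ v → ¬? (v ∈? U)) (allFin n)))
      where
        inGU? : Decidable (λ j → end₁ G j ∉ U × end₂ G j ∉ U)
        inGU? j = ¬? (end₁ G j ∈? U) ×-dec ¬? (end₂ G j ∈? U)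
        deg' : Fin n → Carrier
        deg' v = ∑ (map y (filter (incident? G v) (filter inGU? (allFin m))))

    NSTsum : (v : Fin n) → (∀ US → Dec (IsNST G v US)) → Carrier
    NSTsum v dec =
      ∑ (map (λ US → τT (proj₂ US) * F-minus (proj₁ US))
             (filter dec (cartesianProduct (allSubsets n) (allSubsets m))))

-- Expanding the left-hand side gives one monomial ∏ᵢ y_{f(i)} for every f that chooses at each
-- v_i (i < n) an edge e_{f(i)} incident with it. Moving from v_i along e_{f(i)} defines a map on V
-- fixing v_n; the vertices whose orbit reaches v_n, together with their chosen edges, form a
-- subtree T_f containing v_n, and every other vertex has chosen an edge of G − V(T_f). Conversely,
-- expanding τ(T₀) F(G − V(T₀)) as a product over the non-root vertices, where a vertex of T₀
-- contributes the edge towards v_n and any other vertex an edge of G − V(T₀), yields exactly the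
-- monomials of the f with T_f = T₀. Spanning trees are the subtrees with V(T₀) = V, where F = 1.

module Submission where

open import Defs
open import Level using (Level)
open import Function using (_∘_; id)
open import Function.Definitions using (Injective)
open import Data.Empty using (⊥-elim)
import Data.Empty.Irrelevant as Irrelevant
open import Data.Unit using (tt) renaming (⊤ to Unit)
open import Data.Bool as Bool using (true; false)
open import Data.Product using (_×_; _,_; Σ; ∃; proj₁; proj₂; uncurry)
open import Data.Sum using (_⊎_; inj₁; inj₂)
open import Data.Nat using (ℕ; zero; suc; _≤_; _<_; z≤n; s≤s)
import Data.Nat.Properties as ℕ
open import Data.Nat.GeneralisedArithmetic using (iterate)
open import Data.Nat.Induction using (<-rec)
open import Data.Fin using (Fin; zero; suc; _≟_; fromℕ; inject₁; toℕ)
open import Data.Fin.Properties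
  using (punchInᵢ≢i; any?; all?; ¬∀⟶∃¬; injective⇒≤; fromℕ≢inject₁; inject₁-injective; pigeonhole; toℕ<n)
open import Data.Fin.Subset using (Subset; _∈_; _∉_; _⊆_; ⊤)
open import Data.Fin.Subset.Properties using (_∈?_; ⊆-antisym; ∈⊤)
open import Data.List
  using (List; []; _∷_; map; allFin; _++_; foldr; filter; tabulate; cartesianProductWith; cartesianProduct)
open import Data.List.Properties using (map-++; map-∘; map-tabulate)
import Data.List.Relation.Unary.All as All
open import Data.List.Membership.Propositional.Properties using (∈-allFin)
open import Data.List.Extrema.Nat using (argmax; f[xs]≤f[argmax])
open import Data.Vec as Vec using ([]; _∷_)
open import Data.Vec.Properties using (≡-dec; ∷-injectiveʳ; lookup∘tabulate; []=⇒lookup; lookup⇒[]=)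
import Data.Vec.Functional as Vector
open import Relation.Nullary using (Dec; yes; no; ¬_; contradiction; does)
open import Relation.Nullary.Decidable using (_⊎-dec_; _×-dec_; ¬?; map′)
open import Relation.Unary using (Decidable)
open import Relation.Binary.PropositionalEquality as ≡ using (_≡_; _≢_)
open import Algebra.Bundles using (CommutativeMonoid; CommutativeSemiring; CommutativeRing)
import Algebra.Properties.CommutativeSemigroup as CommutativeSemigroupProperties
import Algebra.Properties.CommutativeMonoid.Sum as CommutativeMonoidSum
import Algebra.Properties.Semiring.Sum as SemiringSum

private
  variable
    ℓx ℓy ℓz ℓp : Level
    X : Set ℓx
    Y : Set ℓy
    Z : Set ℓz

subset : ∀ {n} {P : Fin n → Set ℓp} → Decidable P → Subset n
subset P? = Vec.tabulate (does ∘ P?)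

module _ {n} {P : Fin n → Set ℓp} (P? : Decidable P) {x : Fin n} where

  ∈-subset⁻ : x ∈ subset P? → P x
  ∈-subset⁻ x∈ with P? x | ≡.trans (≡.sym (lookup∘tabulate (does ∘ P?) x)) ([]=⇒lookup x∈)
  ... | yes Px | _ = Px

  ∈-subset⁺ : P x → x ∈ subset P?
  ∈-subset⁺ Px = lookup⇒[]= x _ (≡.trans (lookup∘tabulate (does ∘ P?) x) (accept (P? x)))
    where
      accept : (d : Dec (P x)) → does d ≡ true
      accept (yes _)  = ≡.refl
      accept (no ¬Px) = contradiction Px ¬Px

-- least t ≤ bound satisfying P, or bound when there is none
least : ∀ {P : ℕ → Set ℓp} → (∀ t → Dec (P t)) → ℕ → ℕ
least P? zero = zero
least P? (suc bound) with P? zero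
... | yes _ = zero
... | no  _ = suc (least (P? ∘ suc) bound)

least-holds : ∀ {P : ℕ → Set ℓp} (P? : ∀ t → Dec (P t)) bound t → t ≤ bound → P t → P (least P? bound)
least-holds P? zero zero z≤n Pt = Pt
least-holds P? (suc bound) t t≤ Pt with P? zero | t | t≤
... | yes P0 | _     | _       = P0
... | no ¬P0 | zero  | _       = contradiction Pt ¬P0
... | no _   | suc t | s≤s t≤′ = least-holds (P? ∘ suc) bound t t≤′ Pt

least-minimal : ∀ {P : ℕ → Set ℓp} (P? : ∀ t → Dec (P t)) bound t → P t → least P? bound ≤ t
least-minimal P? zero t Pt = z≤n
least-minimal P? (suc bound) t Pt with P? zero | t
... | yes _  | _     = z≤n
... | no ¬P0 | zero  = contradiction Pt ¬P0
... | no _   | suc t = s≤s (least-minimal (P? ∘ suc) bound t Pt)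

data LastView {k} : Fin (suc k) → Set where
  last   : LastView (fromℕ k)
  inject : (i : Fin k) → LastView (inject₁ i)

lastView : ∀ {k} (v : Fin (suc k)) → LastView v
lastView {zero}  zero    = last
lastView {suc k} zero    = inject zero
lastView {suc k} (suc v) with lastView v
... | last     = last
... | inject i = inject (suc i)

lastView-fromℕ : ∀ k → lastView (fromℕ k) ≡ last
lastView-fromℕ zero = ≡.refl
lastView-fromℕ (suc k) rewrite lastView-fromℕ k = ≡.refl

lastView-inject₁ : ∀ {k} (i : Fin k) → lastView (inject₁ i) ≡ inject i
lastView-inject₁ {suc k} zero    = ≡.refl
lastView-inject₁ {suc k} (suc i) rewrite lastView-inject₁ i = ≡.refl

-- Sums and products over lists and finite sets

module MonoidFold {c ℓ} (M : CommutativeMonoid c ℓ) where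
  open CommutativeMonoid M renaming (Carrier to A)
  open CommutativeSemigroupProperties commutativeSemigroup using (interchange)
  open CommutativeMonoidSum M public using (sum; sum-cong-≋; sum-cong-≗; sum-init-last; ∑-comm; ∑-distrib-+)
  open CommutativeMonoidSum M using (sum-remove; sum-replicate-zero)
  open import Relation.Binary.Reasoning.Setoid setoid

  fold : List A → A
  fold = foldr _∙_ ε

  when : ∀ {P : Set ℓp} → Dec P → A → A
  when (yes _) x = x
  when (no _)  _ = ε

  module _ {P : Set ℓp} {x : A} where

    when-accept : (p? : Dec P) → P → when p? x ≈ x
    when-accept (yes _) _ = refl
    when-accept (no ¬p) p = contradiction p ¬p

    when-reject : (p? : Dec P) → ¬ P → when p? x ≈ ε
    when-reject (yes p) ¬p = contradiction p ¬p
    when-reject (no _)  _  = refl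

    when-cong : ∀ {Q : Set ℓy} (p? : Dec P) (q? : Dec Q) → (P → Q) → (Q → P) → when p? x ≡ when q? x
    when-cong (yes _) (yes _) _   _   = ≡.refl
    when-cong (yes p) (no ¬q) p→q _   = contradiction (p→q p) ¬q
    when-cong (no ¬p) (yes q) _   q→p = contradiction (q→p q) ¬p
    when-cong (no _)  (no _)  _   _   = ≡.refl

    when-× : ∀ {Q : Set ℓy} (p? : Dec P) (q? : Dec Q) → when (p? ×-dec q?) x ≡ when q? (when p? x)
    when-× (yes _) (yes _) = ≡.refl
    when-× (yes _) (no _)  = ≡.refl
    when-× (no _)  (yes _) = ≡.refl
    when-× (no _)  (no _)  = ≡.refl

  fold-++ : ∀ xs ys → fold (xs ++ ys) ≈ fold xs ∙ fold ys
  fold-++ []       ys = sym (identityˡ _)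
  fold-++ (x ∷ xs) ys = trans (∙-congˡ (fold-++ xs ys)) (sym (assoc _ _ _))

  fold-map-cong : ∀ {g h : X → A} xs → (∀ x → g x ≈ h x) → fold (map g xs) ≈ fold (map h xs)
  fold-map-cong []       g≈h = refl
  fold-map-cong (x ∷ xs) g≈h = ∙-cong (g≈h x) (fold-map-cong xs g≈h)

  fold-map-ε : ∀ {g : X → A} xs → (∀ x → g x ≈ ε) → fold (map g xs) ≈ ε
  fold-map-ε []       g≈ε = refl
  fold-map-ε (x ∷ xs) g≈ε = trans (∙-cong (g≈ε x) (fold-map-ε xs g≈ε)) (identityˡ _)

  fold-map-∙ : ∀ (g h : X → A) xs → fold (map (λ x → g x ∙ h x) xs) ≈ fold (map g xs) ∙ fold (map h xs)
  fold-map-∙ g h []       = sym (identityˡ _)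
  fold-map-∙ g h (x ∷ xs) = trans (∙-congˡ (fold-map-∙ g h xs)) (interchange _ _ _ _)

  fold-map-comm : ∀ (g : X → Y → A) xs ys →
    fold (map (λ x → fold (map (g x) ys)) xs) ≈ fold (map (λ y → fold (map (λ x → g x y) xs)) ys)
  fold-map-comm g []       ys = sym (fold-map-ε ys (λ _ → refl))
  fold-map-comm g (x ∷ xs) ys = trans (∙-congˡ (fold-map-comm g xs ys)) (sym (fold-map-∙ (g x) _ ys))

  fold-filter : ∀ {P : X → Set ℓp} (P? : ∀ x → Dec (P x)) (g : X → A) xs →
    fold (map g (filter P? xs)) ≈ fold (map (λ x → when (P? x) (g x)) xs)
  fold-filter P? g [] = refl
  fold-filter P? g (x ∷ xs) with P? x
  ... | yes _ = ∙-congˡ (fold-filter P? g xs)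
  ... | no  _ = trans (fold-filter P? g xs) (sym (identityˡ _))

  fold-cartesianProductWith : ∀ (_⊗_ : X → Y → Z) (g : Z → A) xs ys →
    fold (map g (cartesianProductWith _⊗_ xs ys)) ≈ fold (map (λ x → fold (map (λ y → g (x ⊗ y)) ys)) xs)
  fold-cartesianProductWith _⊗_ g []       ys = refl
  fold-cartesianProductWith _⊗_ g (x ∷ xs) ys = begin
    fold (map g (map (x ⊗_) ys ++ cartesianProductWith _⊗_ xs ys))
      ≡⟨ ≡.cong fold (map-++ g (map (x ⊗_) ys) _) ⟩
    fold (map g (map (x ⊗_) ys) ++ map g (cartesianProductWith _⊗_ xs ys))
      ≈⟨ fold-++ (map g (map (x ⊗_) ys)) _ ⟩
    fold (map g (map (x ⊗_) ys)) ∙ fold (map g (cartesianProductWith _⊗_ xs ys))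
      ≈⟨ ∙-cong (reflexive (≡.cong fold (≡.sym (map-∘ ys)))) (fold-cartesianProductWith _⊗_ g xs ys) ⟩
    fold (map (λ y → g (x ⊗ y)) ys) ∙ fold (map (λ x → fold (map (λ y → g (x ⊗ y)) ys)) xs)
      ∎

  fold-allFin : ∀ {n} (g : Fin n → A) → fold (map g (allFin n)) ≡ sum g
  fold-allFin g = ≡.trans (≡.cong fold (map-tabulate id g)) (fold-tabulate g)
    where
      fold-tabulate : ∀ {n} (t : Fin n → A) → fold (tabulate t) ≡ sum t
      fold-tabulate {zero}  t = ≡.refl
      fold-tabulate {suc n} t = ≡.cong (t zero ∙_) (fold-tabulate (t ∘ suc))

  sum-ε : ∀ {n} (t : Fin n → A) → (∀ i → t i ≈ ε) → sum t ≈ ε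
  sum-ε {n} t t≈ε = trans (sum-cong-≋ t≈ε) (sum-replicate-zero n)

  sum-point : ∀ {n} (t : Fin n → A) a → (∀ i → i ≢ a → t i ≈ ε) → sum t ≈ t a
  sum-point {suc n} t a off = begin
    sum t                          ≈⟨ sum-remove t ⟩
    t a ∙ sum (Vector.removeAt t a) ≈⟨ ∙-congˡ (sum-ε _ (λ i → off _ (punchInᵢ≢i a i))) ⟩
    t a ∙ ε                        ≈⟨ identityʳ _ ⟩
    t a                            ∎

  fold-allSubsets-suc : ∀ {k} (g : Subset (suc k) → A) →
    fold (map g (allSubsets (suc k))) ≈
    fold (map (g ∘ (true ∷_)) (allSubsets k)) ∙ fold (map (g ∘ (false ∷_)) (allSubsets k))
  fold-allSubsets-suc {k} g = begin
    fold (map g (map (true ∷_) (allSubsets k) ++ map (false ∷_) (allSubsets k)))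
      ≡⟨ ≡.cong fold (map-++ g (map (true ∷_) (allSubsets k)) _) ⟩
    fold (map g (map (true ∷_) (allSubsets k)) ++ map g (map (false ∷_) (allSubsets k)))
      ≈⟨ fold-++ (map g (map (true ∷_) (allSubsets k))) _ ⟩
    fold (map g (map (true ∷_) (allSubsets k))) ∙ fold (map g (map (false ∷_) (allSubsets k)))
      ≡⟨ ≡.cong₂ (λ xs ys → fold xs ∙ fold ys) (map-∘ (allSubsets k)) (map-∘ (allSubsets k)) ⟨
    fold (map (g ∘ (true ∷_)) (allSubsets k)) ∙ fold (map (g ∘ (false ∷_)) (allSubsets k))
      ∎

  fold-allSubsets-point : ∀ {k} (g : Subset k → A) U → (∀ W → W ≢ U → g W ≈ ε) →
    fold (map g (allSubsets k)) ≈ g U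
  fold-allSubsets-point g []      off = identityʳ _
  fold-allSubsets-point g (true ∷ U) off = begin
    _ ≈⟨ fold-allSubsets-suc g ⟩
    _ ≈⟨ ∙-cong (fold-allSubsets-point (g ∘ (true ∷_)) U (λ W W≢U → off _ (W≢U ∘ ∷-injectiveʳ)))
                (fold-map-ε (allSubsets _) (λ W → off (false ∷ W) λ ())) ⟩
    _ ≈⟨ identityʳ _ ⟩
    _ ∎
  fold-allSubsets-point g (false ∷ U) off = begin
    _ ≈⟨ fold-allSubsets-suc g ⟩
    _ ≈⟨ ∙-cong (fold-map-ε (allSubsets _) (λ W → off (true ∷ W) λ ()))
                (fold-allSubsets-point (g ∘ (false ∷_)) U (λ W W≢U → off _ (W≢U ∘ ∷-injectiveʳ))) ⟩
    _ ≈⟨ identityˡ _ ⟩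
    _ ∎

  fold-pairs-point : ∀ {k m} (g : Subset k × Subset m → A) a → (∀ x → x ≢ a → g x ≈ ε) →
    fold (map g (cartesianProduct (allSubsets k) (allSubsets m))) ≈ g a
  fold-pairs-point {k} {m} g (U , S) off = begin
    fold (map g (cartesianProduct (allSubsets k) (allSubsets m)))
      ≈⟨ fold-cartesianProductWith _,_ g (allSubsets k) (allSubsets m) ⟩
    fold (map (λ U′ → fold (map (λ S′ → g (U′ , S′)) (allSubsets m))) (allSubsets k))
      ≈⟨ fold-allSubsets-point _ U (λ U′ U′≢U →
           fold-map-ε (allSubsets m) (λ S′ → off _ (U′≢U ∘ ≡.cong proj₁))) ⟩
    fold (map (λ S′ → g (U , S′)) (allSubsets m))
      ≈⟨ fold-allSubsets-point _ S (λ S′ S′≢S → off _ (S′≢S ∘ ≡.cong proj₂)) ⟩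
    g (U , S)
      ∎

functions : ∀ k m → List (Fin k → Fin m)
functions zero    m = (λ ()) ∷ []
functions (suc k) m = cartesianProductWith Vector._∷_ (allFin m) (functions k m)

module SemiringFold {c ℓ} (R : CommutativeSemiring c ℓ) where
  open CommutativeSemiring R hiding (zero)
  module Additive = MonoidFold +-commutativeMonoid
  module Multiplicative = MonoidFold *-commutativeMonoid
  open SemiringSum semiring using (*-distribʳ-sum)
  open import Relation.Binary.Reasoning.Setoid setoid

  *-distribˡ-fold : ∀ x (g : X → Carrier) xs →
    x * Additive.fold (map g xs) ≈ Additive.fold (map (λ z → x * g z) xs)
  *-distribˡ-fold x g []       = zeroʳ x
  *-distribˡ-fold x g (z ∷ xs) = trans (distribˡ x (g z) _) (+-congˡ (*-distribˡ-fold x g xs))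

  ∏-zero : ∀ {n} (x : Fin n → Carrier) i → x i ≈ 0# → Multiplicative.sum x ≈ 0#
  ∏-zero x zero    xᵢ≈0 = trans (*-congʳ xᵢ≈0) (zeroˡ _)
  ∏-zero x (suc i) xᵢ≈0 = trans (*-congˡ (∏-zero (x ∘ suc) i xᵢ≈0)) (zeroʳ _)

  ∏∑-expand : ∀ {k m} (g : Fin k → Fin m → Carrier) →
    Multiplicative.sum (λ i → Additive.sum (g i)) ≈
    Additive.fold (map (λ f → Multiplicative.sum (λ i → g i (f i))) (functions k m))
  ∏∑-expand {zero}      g = sym (+-identityʳ 1#)
  ∏∑-expand {suc k} {m} g = begin
    Additive.sum (g zero) * Multiplicative.sum (λ i → Additive.sum (g (suc i)))
      ≈⟨ *-congˡ (∏∑-expand (g ∘ suc)) ⟩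
    Additive.sum (g zero) * Additive.fold (map tailProduct fs)
      ≈⟨ *-distribʳ-sum _ (g zero) ⟩
    Additive.sum (λ j → g zero j * Additive.fold (map tailProduct fs))
      ≈⟨ Additive.sum-cong-≋ (λ j → *-distribˡ-fold (g zero j) tailProduct fs) ⟩
    Additive.sum (λ j → Additive.fold (map (λ f → g zero j * tailProduct f) fs))
      ≡⟨ ≡.sym (Additive.fold-allFin (λ j → Additive.fold (map (λ f → g zero j * tailProduct f) fs))) ⟩
    Additive.fold (map (λ j → Additive.fold (map (λ f → g zero j * tailProduct f) fs)) (allFin m))
      ≈⟨ sym (Additive.fold-cartesianProductWith Vector._∷_ _ (allFin m) fs) ⟩
    Additive.fold (map (λ f → Multiplicative.sum (λ i → g i (f i))) (functions (suc k) m))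
      ∎
    where
      fs = functions k m
      tailProduct : (Fin k → Fin m) → Carrier
      tailProduct f = Multiplicative.sum (λ i → g (suc i) (f i))

-- Walks, paths and cycles

module Graph {n m} (G : MultiGraph n m) where

  private
    variable
      u v w x a b a′ b′ : Fin n
      j j₀ : Fin m
      S T : Subset m

  other : Fin m → Fin n → Fin n
  other j v with end₁ G j ≟ v
  ... | yes _ = end₂ G j
  ... | no  _ = end₁ G j

  Incident⇒Joins-other : Incident G j v → Joins G j v (other j v)
  Incident⇒Joins-other {j} {v} inc with end₁ G j ≟ v | inc
  ... | yes e₁≡v | _         = inj₁ (e₁≡v , ≡.refl)
  ... | no  e₁≢v | inj₁ e₁≡v = contradiction e₁≡v e₁≢v
  ... | no  _    | inj₂ e₂≡v = inj₂ (≡.refl , e₂≡v)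

  Joins⇒other≡ : Joins G j v x → other j v ≡ x
  Joins⇒other≡ {j} {v} jn with end₁ G j ≟ v | jn
  ... | yes _    | inj₁ (_ , e₂≡x)      = e₂≡x
  ... | yes e₁≡v | inj₂ (e₁≡x , e₂≡v)   = ≡.trans e₂≡v (≡.trans (≡.sym e₁≡v) e₁≡x)
  ... | no  e₁≢v | inj₁ (e₁≡v , _)      = contradiction e₁≡v e₁≢v
  ... | no  _    | inj₂ (e₁≡x , _)      = e₁≡x

  other-end : ∀ j v → other j v ≡ end₁ G j ⊎ other j v ≡ end₂ G j
  other-end j v with end₁ G j ≟ v
  ... | yes _ = inj₂ ≡.refl
  ... | no  _ = inj₁ ≡.refl

  Joins⇒Incident : Joins G j a b → Incident G j a
  Joins⇒Incident (inj₁ (e₁≡a , _)) = inj₁ e₁≡a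
  Joins⇒Incident (inj₂ (_ , e₂≡a)) = inj₂ e₂≡a

  Joins-sym : Joins G j a b → Joins G j b a
  Joins-sym (inj₁ jn) = inj₂ jn
  Joins-sym (inj₂ jn) = inj₁ jn

  Joins-unique : Joins G j a b → Joins G j a′ b′ → (a ≡ a′ × b ≡ b′) ⊎ (a ≡ b′ × b ≡ a′)
  Joins-unique (inj₁ (p , q)) (inj₁ (p′ , q′)) = inj₁ (≡.trans (≡.sym p) p′ , ≡.trans (≡.sym q) q′)
  Joins-unique (inj₁ (p , q)) (inj₂ (p′ , q′)) = inj₂ (≡.trans (≡.sym p) p′ , ≡.trans (≡.sym q) q′)
  Joins-unique (inj₂ (p , q)) (inj₁ (p′ , q′)) = inj₂ (≡.trans (≡.sym q) q′ , ≡.trans (≡.sym p) p′)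
  Joins-unique (inj₂ (p , q)) (inj₂ (p′ , q′)) = inj₁ (≡.trans (≡.sym q) q′ , ≡.trans (≡.sym p) p′)

  module _ {ℓ} {P : Fin n → Set ℓ} where

    Joins⇒ends : Joins G j a b → P a → P b → P (end₁ G j) × P (end₂ G j)
    Joins⇒ends (inj₁ (≡.refl , ≡.refl)) Pa Pb = Pa , Pb
    Joins⇒ends (inj₂ (≡.refl , ≡.refl)) Pa Pb = Pb , Pa

    ends⇒Joins : Joins G j a b → P (end₁ G j) → P (end₂ G j) → P a × P b
    ends⇒Joins (inj₁ (≡.refl , ≡.refl)) P₁ P₂ = P₁ , P₂
    ends⇒Joins (inj₂ (≡.refl , ≡.refl)) P₁ P₂ = P₂ , P₁

  length : Walk G S u w → ℕ
  length []               = zero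
  length (step _ _ _ W) = suc (length W)

  vertexAt : (W : Walk G S u w) → Fin (suc (length W)) → Fin n
  vertexAt {u = u} W              zero    = u
  vertexAt         (step _ _ _ W) (suc i) = vertexAt W i

  vertexAt-last : (W : Walk G S u w) → vertexAt W (fromℕ (length W)) ≡ w
  vertexAt-last []             = ≡.refl
  vertexAt-last (step _ _ _ W) = vertexAt-last W

  edgeAt : (W : Walk G S u w) → Fin (length W) → Fin m
  edgeAt (step j _ _ W) zero    = j
  edgeAt (step _ _ _ W) (suc i) = edgeAt W i

  edgeAt-∈ : (W : Walk G S u w) (i : Fin (length W)) → edgeAt W i ∈ S
  edgeAt-∈ (step _ j∈S _ W) zero    = j∈S
  edgeAt-∈ (step _ _   _ W) (suc i) = edgeAt-∈ W i

  edgeAt-joins : (W : Walk G S u w) (i : Fin (length W)) →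
                 Joins G (edgeAt W i) (vertexAt W (inject₁ i)) (vertexAt W (suc i))
  edgeAt-joins (step _ _ jn W) zero    = jn
  edgeAt-joins (step _ _ _  W) (suc i) = edgeAt-joins W i

  _++ʷ_ : Walk G S u x → Walk G S x w → Walk G S u w
  []               ++ʷ W′ = W′
  step j j∈S jn W ++ʷ W′ = step j j∈S jn (W ++ʷ W′)

  reverseʷ : Walk G S u w → Walk G S w u
  reverseʷ []                = []
  reverseʷ (step j j∈S jn W) = reverseʷ W ++ʷ step j j∈S (Joins-sym jn) []

  IsPath : Walk G S u w → Set
  IsPath []                   = Unit
  IsPath (step {u} _ _ _ W) = (∀ i → vertexAt W i ≢ u) × IsPath W

  isPath⇒vertexAt-injective : (W : Walk G S u w) → IsPath W → Injective _≡_ _≡_ (vertexAt W)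
  isPath⇒vertexAt-injective W              _          {zero}  {zero}   _ = ≡.refl
  isPath⇒vertexAt-injective (step _ _ _ W) (u∉W , _)  {zero}  {suc i′} e = contradiction (≡.sym e) (u∉W i′)
  isPath⇒vertexAt-injective (step _ _ _ W) (u∉W , _)  {suc i} {zero}   e = contradiction e (u∉W i)
  isPath⇒vertexAt-injective (step _ _ _ W) (_ , isP) {suc i} {suc i′} e =
    ≡.cong suc (isPath⇒vertexAt-injective W isP e)

  fresh-edge : (W : Walk G S x w) → (∀ i → vertexAt W i ≢ u) → Joins G j u x → ∀ i → j ≢ edgeAt W i
  fresh-edge W u∉W jn i j≡eᵢ
    with Joins-unique jn (≡.subst (λ e → Joins G e _ _) (≡.sym j≡eᵢ) (edgeAt-joins W i))
  ... | inj₁ (u≡ , _) = u∉W (inject₁ i) (≡.sym u≡)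
  ... | inj₂ (u≡ , _) = u∉W (suc i) (≡.sym u≡)

  isPath⇒edgeAt-injective : (W : Walk G S u w) → IsPath W → Injective _≡_ _≡_ (edgeAt W)
  isPath⇒edgeAt-injective (step _ _ _  W) _          {zero}  {zero}   _ = ≡.refl
  isPath⇒edgeAt-injective (step _ _ jn W) (u∉W , _)  {zero}  {suc i′} e =
    contradiction e (fresh-edge W u∉W jn i′)
  isPath⇒edgeAt-injective (step _ _ jn W) (u∉W , _)  {suc i} {zero}   e =
    contradiction (≡.sym e) (fresh-edge W u∉W jn i)
  isPath⇒edgeAt-injective (step _ _ _  W) (_ , isP) {suc i} {suc i′} e =
    ≡.cong suc (isPath⇒edgeAt-injective W isP e)

  isPath⇒length< : (W : Walk G S u w) → IsPath W → length W < n
  isPath⇒length< W isP = injective⇒≤ (isPath⇒vertexAt-injective W isP)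

  suffix : (W : Walk G S u w) (i : Fin (suc (length W))) → Walk G S (vertexAt W i) w
  suffix W              zero    = W
  suffix (step _ _ _ W) (suc i) = suffix W i

  suffix-isPath : (W : Walk G S u w) (i : Fin (suc (length W))) → IsPath W → IsPath (suffix W i)
  suffix-isPath W              zero    isP       = isP
  suffix-isPath (step _ _ _ W) (suc i) (_ , isP) = suffix-isPath W i isP

  toPath : Walk G S u w → Σ (Walk G S u w) IsPath
  toPath [] = [] , tt
  toPath {S = S} {w = w} (step {u} j j∈S jn W) with toPath W
  ... | P , isP with any? (λ i → vertexAt P i ≟ u)
  ... | yes (i , Pᵢ≡u) = ≡.subst (λ z → Σ (Walk G S z w) IsPath) Pᵢ≡u (suffix P i , suffix-isPath P i isP)
  ... | no  u∉P        = step j j∈S jn P , (λ i Pᵢ≡u → u∉P (i , Pᵢ≡u)) , isP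

  path+edge⇒cycle : S ⊆ T → j₀ ∉ S → j₀ ∈ T → Joins G j₀ b a →
                    (W : Walk G S a b) → IsPath W → Cycle G T
  path+edge⇒cycle {S} {T} {j₀} {b} {a} S⊆T j₀∉S j₀∈T jn W isP = record
    { len      = length W
    ; edge     = edge
    ; vert     = vert
    ; closed   = vertexAt-last W
    ; edges-in = edges-in
    ; joins    = joins
    ; edge-inj = λ _ _ → edge-injective
    ; vert-inj = λ _ _ → vert-injective
    }
    where
      edge : Fin (suc (length W)) → Fin m
      edge zero    = j₀
      edge (suc i) = edgeAt W i

      vert : Fin (suc (suc (length W))) → Fin n
      vert zero    = b
      vert (suc i) = vertexAt W i

      edges-in : ∀ i → edge i ∈ T
      edges-in zero    = j₀∈T
      edges-in (suc i) = S⊆T (edgeAt-∈ W i)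

      joins : ∀ i → Joins G (edge i) (vert (inject₁ i)) (vert (suc i))
      joins zero    = jn
      joins (suc i) = edgeAt-joins W i

      edge-injective : Injective _≡_ _≡_ edge
      edge-injective {zero}  {zero}   _ = ≡.refl
      edge-injective {zero}  {suc i′} e = contradiction (≡.subst (_∈ S) (≡.sym e) (edgeAt-∈ W i′)) j₀∉S
      edge-injective {suc i} {zero}   e = contradiction (≡.subst (_∈ S) e (edgeAt-∈ W i)) j₀∉S
      edge-injective {suc i} {suc i′} e = ≡.cong suc (isPath⇒edgeAt-injective W isP e)

      b≢ : ∀ i → b ≢ vertexAt W (inject₁ i)
      b≢ i e = fromℕ≢inject₁
        (isPath⇒vertexAt-injective W isP {fromℕ (length W)} {inject₁ i} (≡.trans (vertexAt-last W) e))

      vert-injective : Injective _≡_ _≡_ (vert ∘ inject₁)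
      vert-injective {zero}  {zero}   _ = ≡.refl
      vert-injective {zero}  {suc i′} e = contradiction e (b≢ i′)
      vert-injective {suc i} {zero}   e = contradiction (≡.sym e) (b≢ i)
      vert-injective {suc i} {suc i′} e = ≡.cong suc (inject₁-injective (isPath⇒vertexAt-injective W isP e))

  module _ {S : Subset m} (C : Cycle G S) where
    open Cycle C

    cycle-vertex : ∀ x → ∃ λ c → vert x ≡ vert (inject₁ c)
    cycle-vertex x with lastView x
    ... | last     = zero , closed
    ... | inject c = c , ≡.refl

    cycle-predecessor : ∀ c → ∃ λ p → vert (suc p) ≡ vert (inject₁ c)
    cycle-predecessor zero    = fromℕ len , closed
    cycle-predecessor (suc c) = inject₁ c , ≡.refl

-- Parent edges of a rooted tree

module RootedTree {n m} (G : MultiGraph n m) {U : Subset n} {S : Subset m}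
                  (tree : IsTree G U S) {r : Fin n} (r∈U : r ∈ U) where
  open Graph G

  private
    variable
      s : ℕ
      v w : Fin n
      j : Fin m

  ends∈U : j ∈ S → end₁ G j ∈ U × end₂ G j ∈ U
  ends∈U = proj₁ (proj₂ tree) _

  walkIn : v ∈ U → w ∈ U → Walk G S v w
  walkIn = proj₁ (proj₂ (proj₂ tree)) _ _

  acyclic : ¬ Cycle G S
  acyclic = proj₂ (proj₂ (proj₂ tree))

  Near : ℕ → Fin n → Set
  Near zero    v = v ≡ r
  Near (suc s) v = v ≡ r ⊎ ∃ λ j → j ∈ S × Incident G j v × Near s (other j v)

  near? : ∀ s v → Dec (Near s v)
  near? zero    v = v ≟ r
  near? (suc s) v = (v ≟ r) ⊎-dec any? (λ j → (j ∈? S) ×-dec (incident? G v j ×-dec near? s (other j v)))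

  Near-mono : ∀ {s s′} → s ≤ s′ → Near s v → Near s′ v
  Near-mono {s′ = zero}  z≤n       near = near
  Near-mono {s′ = suc _} z≤n       v≡r  = inj₁ v≡r
  Near-mono              (s≤s _)   (inj₁ v≡r) = inj₁ v≡r
  Near-mono              (s≤s s≤s′) (inj₂ (j , j∈S , inc , near)) =
    inj₂ (j , j∈S , inc , Near-mono s≤s′ near)

  walk⇒Near : (W : Walk G S v r) → Near (length W) v
  walk⇒Near []                = ≡.refl
  walk⇒Near (step j j∈S jn W) =
    inj₂ (j , j∈S , Joins⇒Incident jn , ≡.subst (Near _) (≡.sym (Joins⇒other≡ jn)) (walk⇒Near W))

  ∈U⇒Near : v ∈ U → Near n v
  ∈U⇒Near v∈U with toPath (walkIn v∈U r∈U)
  ... | P , isP = Near-mono (ℕ.<⇒≤ (isPath⇒length< P isP)) (walk⇒Near P)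

  dist : Fin n → ℕ
  dist v = least (λ s → near? s v) n

  dist-near : v ∈ U → Near (dist v) v
  dist-near {v} v∈U = least-holds (λ s → near? s v) n n ℕ.≤-refl (∈U⇒Near v∈U)

  dist-minimal : ∀ s → Near s v → dist v ≤ s
  dist-minimal {v} = least-minimal (λ s → near? s v) n

  record IsParentEdge (v : Fin n) (j : Fin m) : Set where
    field
      ∈S      : j ∈ S
      joins   : Joins G j v (other j v)
      other∈U : other j v ∈ U
      dist≡   : suc (dist (other j v)) ≡ dist v

  firstEdge : Near s v → .(v ≢ r) → Fin m
  firstEdge {zero}  v≡r                  v≢r = Irrelevant.⊥-elim (v≢r v≡r)
  firstEdge {suc s} (inj₁ v≡r)           v≢r = Irrelevant.⊥-elim (v≢r v≡r)
  firstEdge {suc s} (inj₂ (j , _ , _ , _)) _   = j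

  firstEdge-isParentEdge : (near : Near s v) (v≢r : v ≢ r) → s ≡ dist v → IsParentEdge v (firstEdge near v≢r)
  firstEdge-isParentEdge {zero}  v≡r        v≢r _ = contradiction v≡r v≢r
  firstEdge-isParentEdge {suc s} (inj₁ v≡r) v≢r _ = contradiction v≡r v≢r
  firstEdge-isParentEdge {suc s} {v} (inj₂ (j , j∈S , inc , near)) _ s≡dist = record
    { ∈S      = j∈S
    ; joins   = joins
    ; other∈U = other∈U
    ; dist≡   = ℕ.≤-antisym
        (≡.subst (suc (dist (other j v)) ≤_) s≡dist (s≤s (dist-minimal s near)))
        (dist-minimal _ (inj₂ (j , j∈S , inc , dist-near other∈U)))
    }
    where
      joins : Joins G j v (other j v)
      joins = Incident⇒Joins-other inc
      other∈U : other j v ∈ U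
      other∈U = proj₂ (ends⇒Joins {P = _∈ U} joins (proj₁ (ends∈U j∈S)) (proj₂ (ends∈U j∈S)))

  -- deciding Near afresh, rather than using dist-near, makes parent independent of its irrelevant arguments
  parentFrom : Dec (Near (dist v) v) → .(v ∈ U) → .(v ≢ r) → Fin m
  parentFrom (yes near) _   v≢r = firstEdge near v≢r
  parentFrom (no ¬near) v∈U _   = Irrelevant.⊥-elim (¬near (dist-near v∈U))

  parent : .(v ∈ U) → .(v ≢ r) → Fin m
  parent {v} = parentFrom (near? (dist v) v)

  parent-isParentEdge : (v∈U : v ∈ U) (v≢r : v ≢ r) → IsParentEdge v (parent v∈U v≢r)
  parent-isParentEdge {v} v∈U v≢r with near? (dist v) v
  ... | yes near = firstEdge-isParentEdge near v≢r ≡.refl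
  ... | no ¬near = contradiction (dist-near v∈U) ¬near

  parent-injective : (v∈U : v ∈ U) (v≢r : v ≢ r) (w∈U : w ∈ U) (w≢r : w ≢ r) →
                     parent v∈U v≢r ≡ parent w∈U w≢r → v ≡ w
  parent-injective {v} {w} v∈U v≢r w∈U w≢r same =
    resolve (Joins-unique (IsParentEdge.joins pv)
                          (≡.subst (λ e → Joins G e w (other pw-edge w)) (≡.sym same) (IsParentEdge.joins pw)))
    where
      pv-edge = parent v∈U v≢r
      pw-edge = parent w∈U w≢r
      pv = parent-isParentEdge v∈U v≢r
      pw = parent-isParentEdge w∈U w≢r
      resolve : (v ≡ w × other pv-edge v ≡ other pw-edge w) ⊎ (v ≡ other pw-edge w × other pv-edge v ≡ w) →
                v ≡ w
      resolve (inj₁ (v≡w , _)) = v≡w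
      resolve (inj₂ (v≡ , ≡w)) = ⊥-elim (ℕ.<-irrefl dist-loop (ℕ.n≤1+n (suc (dist v))))
        where
          dist-loop : dist v ≡ suc (suc (dist v))
          dist-loop = ≡.trans (≡.sym (IsParentEdge.dist≡ pv))
                      (≡.trans (≡.cong (suc ∘ dist) ≡w)
                      (≡.trans (≡.sym (≡.cong suc (IsParentEdge.dist≡ pw)))
                               (≡.cong (λ x → suc (suc (dist x))) (≡.sym v≡))))

  parent-induction : ∀ {ℓ} (P : Fin n → Set ℓ) → P r →
    (∀ {v} (v∈U : v ∈ U) (v≢r : v ≢ r) → P (other (parent v∈U v≢r) v) → P v) → v ∈ U → P v
  parent-induction P Pr up v∈U = go _ v∈U ≡.refl
    where
      go : ∀ d {v} → v ∈ U → dist v ≡ d → P v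
      go d {v} v∈U dist≡d with v ≟ r
      ... | yes ≡.refl = Pr
      ... | no v≢r with IsParentEdge.dist≡ (parent-isParentEdge v∈U v≢r) | d
      ...   | dist≡ | zero  = contradiction (≡.trans dist≡ dist≡d) λ ()
      ...   | dist≡ | suc d = up v∈U v≢r (go d (IsParentEdge.other∈U (parent-isParentEdge v∈U v≢r))
                                              (ℕ.suc-injective (≡.trans dist≡ dist≡d)))

  walkUp : ∀ {T} → (∀ {v} (v∈U : v ∈ U) (v≢r : v ≢ r) → parent v∈U v≢r ∈ T) → v ∈ U → Walk G T v r
  walkUp {T = T} parent∈T = parent-induction (λ v → Walk G T v r) []
    (λ v∈U v≢r → step _ (parent∈T v∈U v≢r) (IsParentEdge.joins (parent-isParentEdge v∈U v≢r)))

  HasChild : Fin m → Fin n → Set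
  HasChild j v = Σ (v ∈ U) λ v∈U → Σ (v ≢ r) λ v≢r → parent v∈U v≢r ≡ j

  hasChild? : ∀ j v → Dec (HasChild j v)
  hasChild? j v with v ∈? U | v ≟ r
  ... | no v∉U | _        = no (v∉U ∘ proj₁)
  ... | yes _  | yes v≡r  = no (λ (_ , v≢r , _) → v≢r v≡r)
  ... | yes v∈U | no v≢r with parent v∈U v≢r ≟ j
  ...   | yes ≡j = yes (v∈U , v≢r , ≡j)
  ...   | no ≢j  = no (λ (_ , _ , ≡j) → ≢j ≡j)

  -- otherwise walking up from both ends of j avoids j and closes a cycle with it
  parent-onto : j ∈ S → ∃ (HasChild j)
  parent-onto {j} j∈S with any? (hasChild? j)
  ... | yes child = child
  ... | no ¬child = contradiction cycle acyclic
    where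
      other-edge? : Decidable (λ e → e ∈ S × e ≢ j)
      other-edge? e = (e ∈? S) ×-dec ¬? (e ≟ j)
      T : Subset m
      T = subset other-edge?
      parent∈T : ∀ {v} (v∈U : v ∈ U) (v≢r : v ≢ r) → parent v∈U v≢r ∈ T
      parent∈T v∈U v≢r =
        ∈-subset⁺ other-edge? (IsParentEdge.∈S (parent-isParentEdge v∈U v≢r) , λ ≡j → ¬child (_ , v∈U , v≢r , ≡j))
      W : Walk G T (end₁ G j) (end₂ G j)
      W = walkUp parent∈T (proj₁ (ends∈U j∈S)) ++ʷ reverseʷ (walkUp parent∈T (proj₂ (ends∈U j∈S)))
      cycle : Cycle G S
      cycle = path+edge⇒cycle (proj₁ ∘ ∈-subset⁻ other-edge?) (λ j∈T → proj₂ (∈-subset⁻ other-edge? j∈T) ≡.refl)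
                              j∈S (inj₂ (≡.refl , ≡.refl)) (proj₁ (toPath W)) (proj₂ (toPath W))

-- The subtree determined by a choice of edges

module FunctionalGraph {k m} (G : MultiGraph (suc k) m) (f : Fin k → Fin m) where
  open Graph G
  open import Data.Nat using (_+_; _∸_)

  private
    n = suc k
    r = fromℕ k
    variable
      s t : ℕ
      v : Fin n
      j : Fin m

  next : Fin n → Fin n
  next v with lastView v
  ... | last     = r
  ... | inject i = other (f i) (inject₁ i)

  next-root : next r ≡ r
  next-root rewrite lastView-fromℕ k = ≡.refl

  next-inject₁ : ∀ i → next (inject₁ i) ≡ other (f i) (inject₁ i)
  next-inject₁ i rewrite lastView-inject₁ i = ≡.refl

  iterate-root : ∀ t → iterate next r t ≡ r
  iterate-root zero    = ≡.refl
  iterate-root (suc t) = ≡.trans (≡.cong (λ x → iterate next x t) next-root) (iterate-root t)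

  iterate-+ : ∀ s t v → iterate next v (s + t) ≡ iterate next (iterate next v s) t
  iterate-+ zero    t v = ≡.refl
  iterate-+ (suc s) t v = iterate-+ s t (next v)

  iterate-suc : ∀ t v → iterate next v (suc t) ≡ next (iterate next v t)
  iterate-suc zero    v = ≡.refl
  iterate-suc (suc t) v = iterate-suc t (next v)

  iterate-stays : s ≤ t → iterate next v s ≡ r → iterate next v t ≡ r
  iterate-stays {s} {t} {v} s≤t eq = begin
    iterate next v t                        ≡⟨ ≡.cong (iterate next v) (ℕ.m+[n∸m]≡n s≤t) ⟨
    iterate next v (s + (t ∸ s))            ≡⟨ iterate-+ s (t ∸ s) v ⟩
    iterate next (iterate next v s) (t ∸ s) ≡⟨ ≡.cong (λ x → iterate next x (t ∸ s)) eq ⟩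
    iterate next r (t ∸ s)                  ≡⟨ iterate-root (t ∸ s) ⟩
    r                                       ∎
    where open ≡.≡-Reasoning

  -- among the first n + 1 iterates two coincide, and cutting out the loop between them shortens the orbit
  iterate-shortcut : n < t → iterate next v t ≡ r → ∃ λ t′ → t′ < t × iterate next v t′ ≡ r
  iterate-shortcut {t} {v} n<t eq with pigeonhole (ℕ.n<1+n n) (λ x → iterate next v (toℕ x))
  ... | a , b , a<b , same = toℕ a + (t ∸ toℕ b) , shorter , reaches
    where
      open ≡.≡-Reasoning
      b≤t : toℕ b ≤ t
      b≤t = ℕ.≤-trans (ℕ.≤-pred (toℕ<n b)) (ℕ.<⇒≤ n<t)
      shorter : toℕ a + (t ∸ toℕ b) < t
      shorter = ≡.subst (toℕ a + (t ∸ toℕ b) <_) (ℕ.m+[n∸m]≡n b≤t) (ℕ.+-monoˡ-< (t ∸ toℕ b) a<b)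
      reaches : iterate next v (toℕ a + (t ∸ toℕ b)) ≡ r
      reaches = begin
        iterate next v (toℕ a + (t ∸ toℕ b))                  ≡⟨ iterate-+ (toℕ a) _ v ⟩
        iterate next (iterate next v (toℕ a)) (t ∸ toℕ b)     ≡⟨ ≡.cong (λ x → iterate next x (t ∸ toℕ b)) same ⟩
        iterate next (iterate next v (toℕ b)) (t ∸ toℕ b)     ≡⟨ iterate-+ (toℕ b) _ v ⟨
        iterate next v (toℕ b + (t ∸ toℕ b))                  ≡⟨ ≡.cong (iterate next v) (ℕ.m+[n∸m]≡n b≤t) ⟩
        iterate next v t                                      ≡⟨ eq ⟩
        r                                                     ∎

  iterate-bound : ∀ t → iterate next v t ≡ r → iterate next v n ≡ r
  iterate-bound {v} = <-rec (λ t → iterate next v t ≡ r → iterate next v n ≡ r) bound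
    where
      bound : ∀ t → (∀ {t′} → t′ < t → iterate next v t′ ≡ r → iterate next v n ≡ r) →
              iterate next v t ≡ r → iterate next v n ≡ r
      bound t shorter eq with t ℕ.≤? n
      ... | yes t≤n = iterate-stays t≤n eq
      ... | no  t≰n with iterate-shortcut (ℕ.≰⇒> t≰n) eq
      ...   | t′ , t′<t , eq′ = shorter t′<t eq′

  reaches? : Decidable (λ v → iterate next v n ≡ r)
  reaches? v = iterate next v n ≟ r

  Uᶠ : Subset n
  Uᶠ = subset reaches?

  ∈Uᶠ⁺ : ∀ t → iterate next v t ≡ r → v ∈ Uᶠ
  ∈Uᶠ⁺ t eq = ∈-subset⁺ reaches? (iterate-bound t eq)

  ∈Uᶠ⁻ : v ∈ Uᶠ → iterate next v n ≡ r
  ∈Uᶠ⁻ = ∈-subset⁻ reaches?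

  r∈Uᶠ : r ∈ Uᶠ
  r∈Uᶠ = ∈Uᶠ⁺ 0 ≡.refl

  next∈Uᶠ : v ∈ Uᶠ → next v ∈ Uᶠ
  next∈Uᶠ {v} v∈Uᶠ =
    ∈Uᶠ⁺ n (≡.trans (iterate-suc n v) (≡.trans (≡.cong next (∈Uᶠ⁻ v∈Uᶠ)) next-root))

  next∈Uᶠ⁻ : next v ∈ Uᶠ → v ∈ Uᶠ
  next∈Uᶠ⁻ next∈Uᶠ = ∈Uᶠ⁺ (suc n) (∈Uᶠ⁻ next∈Uᶠ)

  treeEdge? : Decidable (λ j → ∃ λ i → inject₁ i ∈ Uᶠ × f i ≡ j)
  treeEdge? j = any? (λ i → (inject₁ i ∈? Uᶠ) ×-dec (f i ≟ j))

  Sᶠ : Subset m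
  Sᶠ = subset treeEdge?

  depth : Fin n → ℕ
  depth v = least (λ t → iterate next v t ≟ r) n

  depth-reaches : v ∈ Uᶠ → iterate next v (depth v) ≡ r
  depth-reaches {v} v∈Uᶠ = least-holds (λ t → iterate next v t ≟ r) n n ℕ.≤-refl (∈Uᶠ⁻ v∈Uᶠ)

  depth-minimal : ∀ t → iterate next v t ≡ r → depth v ≤ t
  depth-minimal {v} = least-minimal (λ t → iterate next v t ≟ r) n

  depth-next : ∀ i → inject₁ i ∈ Uᶠ → depth (inject₁ i) ≡ suc (depth (next (inject₁ i)))
  depth-next i u∈Uᶠ = ℕ.≤-antisym
    (depth-minimal (suc (depth (next u))) (depth-reaches (next∈Uᶠ u∈Uᶠ)))
    (next-depth-< (depth u) (depth-reaches u∈Uᶠ))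
    where
      u = inject₁ i
      next-depth-< : ∀ t → iterate next u t ≡ r → suc (depth (next u)) ≤ t
      next-depth-< zero    u≡r = contradiction u≡r (fromℕ≢inject₁ ∘ ≡.sym)
      next-depth-< (suc t) eq  = s≤s (depth-minimal t eq)

  module _ (incident : ∀ i → Incident G (f i) (inject₁ i)) where

    Joins-next : ∀ i → Joins G (f i) (inject₁ i) (next (inject₁ i))
    Joins-next i = ≡.subst (Joins G (f i) (inject₁ i)) (≡.sym (next-inject₁ i)) (Incident⇒Joins-other (incident i))

    f∈Sᶠ : ∀ {i} → inject₁ i ∈ Uᶠ → f i ∈ Sᶠ
    f∈Sᶠ {i} u∈Uᶠ = ∈-subset⁺ treeEdge? (i , u∈Uᶠ , ≡.refl)

    walkToRoot : v ∈ Uᶠ → Walk G Sᶠ v r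
    walkToRoot v∈Uᶠ = go n v∈Uᶠ (∈Uᶠ⁻ v∈Uᶠ)
      where
        go : ∀ t {v} → v ∈ Uᶠ → iterate next v t ≡ r → Walk G Sᶠ v r
        go t {v} v∈Uᶠ eq with lastView v | t
        ... | last     | _     = []
        ... | inject i | zero  = contradiction eq (fromℕ≢inject₁ ∘ ≡.sym)
        ... | inject i | suc t = step (f i) (f∈Sᶠ v∈Uᶠ) (Joins-next i) (go t (next∈Uᶠ v∈Uᶠ) eq)

    Sᶠ-ends : j ∈ Sᶠ → end₁ G j ∈ Uᶠ × end₂ G j ∈ Uᶠ
    Sᶠ-ends j∈Sᶠ with ∈-subset⁻ treeEdge? j∈Sᶠ
    ... | i , u∈Uᶠ , ≡.refl = Joins⇒ends {P = _∈ Uᶠ} (Joins-next i) u∈Uᶠ (next∈Uᶠ u∈Uᶠ)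

    Sᶠ-loopless : j ∈ Sᶠ → ¬ Joins G j v v
    Sᶠ-loopless j∈Sᶠ jn with ∈-subset⁻ treeEdge? j∈Sᶠ
    ... | i , u∈Uᶠ , ≡.refl = ℕ.1+n≢n (≡.trans (≡.sym (depth-next i u∈Uᶠ)) (≡.cong depth u≡next))
      where
        u≡next : inject₁ i ≡ next (inject₁ i)
        u≡next with Joins-unique jn (Joins-next i)
        ... | inj₁ (v≡u , v≡next) = ≡.trans (≡.sym v≡u) v≡next
        ... | inj₂ (v≡next , v≡u) = ≡.trans (≡.sym v≡u) v≡next

    child-edge : ∀ {a b} → j ∈ Sᶠ → Joins G j a b → depth b ≤ depth a →
                 ∃ λ i → j ≡ f i × a ≡ inject₁ i
    child-edge j∈Sᶠ jn b≤a with ∈-subset⁻ treeEdge? j∈Sᶠ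
    ... | i , u∈Uᶠ , ≡.refl with Joins-unique jn (Joins-next i)
    ...   | inj₁ (a≡u , _)    = i , ≡.refl , a≡u
    ...   | inj₂ (a≡next , b≡u) = contradiction (≡.subst₂ _≤_ b-deeper ≡.refl b≤a) ℕ.1+n≰n
      where
        b-deeper : depth _ ≡ suc (depth _)
        b-deeper =
          ≡.trans (≡.cong depth b≡u) (≡.trans (depth-next i u∈Uᶠ) (≡.cong (suc ∘ depth) (≡.sym a≡next)))

    -- both cycle edges at a deepest cycle vertex lead to shallower vertices, so both are its own edge f i
    acyclic : ¬ Cycle G Sᶠ
    acyclic C = Sᶠ-loopless (edges-in P) loop
      where
        open Cycle C
        height : Fin (suc len) → ℕ
        height c = depth (vert (inject₁ c))
        M : Fin (suc len)
        M = argmax height zero (allFin (suc len))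
        M-deepest : ∀ c → height c ≤ height M
        M-deepest c = All.lookup (f[xs]≤f[argmax] {f = height} zero (allFin (suc len))) (∈-allFin c)
        below-M : ∀ x → depth (vert x) ≤ height M
        below-M x = ≡.subst (λ y → depth y ≤ height M) (≡.sym (proj₂ (cycle-vertex C x))) (M-deepest (proj₁ (cycle-vertex C x)))
        P : Fin (suc len)
        P = proj₁ (cycle-predecessor C M)
        P→M : vert (suc P) ≡ vert (inject₁ M)
        P→M = proj₂ (cycle-predecessor C M)
        ChildEdge : Fin (suc len) → Set
        ChildEdge c = ∃ λ i → edge c ≡ f i × vert (inject₁ M) ≡ inject₁ i
        M-child : ChildEdge M
        M-child = child-edge (edges-in M) (joins M) (below-M (suc M))
        P-child : ChildEdge P
        P-child = child-edge (edges-in P) (≡.subst (λ x → Joins G (edge P) x (vert (inject₁ P))) P→M (Joins-sym (joins P)))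
                             (M-deepest P)
        same-child : ∀ {c d} → ChildEdge c → ChildEdge d → c ≡ d
        same-child {c} {d} (i , ec , xc) (i′ , ed , xd) =
          edge-inj c d (≡.trans ec (≡.trans (≡.cong f (inject₁-injective (≡.trans (≡.sym xc) xd))) (≡.sym ed)))
        loop : Joins G (edge P) (vert (inject₁ P)) (vert (inject₁ P))
        loop = ≡.subst (Joins G (edge P) (vert (inject₁ P))) (≡.trans P→M (≡.cong (vert ∘ inject₁) (same-child M-child P-child)))
                       (joins P)

    isTree : IsTree G Uᶠ Sᶠ
    isTree = (r , r∈Uᶠ) , (λ _ → Sᶠ-ends)
           , (λ _ _ u∈Uᶠ w∈Uᶠ → walkToRoot u∈Uᶠ ++ʷ reverseʷ (walkToRoot w∈Uᶠ)) , acyclic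

module Compatibility {k m} (G : MultiGraph (suc k) m) {U : Subset (suc k)} {S : Subset m}
                     (tree : IsTree G U S) (r∈U : fromℕ k ∈ U) where
  open Graph G
  open RootedTree G tree r∈U

  inject₁≢root : ∀ (i : Fin k) → inject₁ i ≢ fromℕ k
  inject₁≢root i = fromℕ≢inject₁ ∘ ≡.sym

  parentOf : ∀ i → .(inject₁ i ∈ U) → Fin m
  parentOf i u∈U = parent u∈U (inject₁≢root i)

  OutsideEdge : Fin m → Set
  OutsideEdge j = end₁ G j ∉ U × end₂ G j ∉ U

  outsideEdge? : Decidable OutsideEdge
  outsideEdge? j = ¬? (end₁ G j ∈? U) ×-dec ¬? (end₂ G j ∈? U)

  -- the edges e_j that can be chosen for v_i when τ(T) F(G − U) is expanded as a product over i < k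
  Admissible : Fin k → Fin m → Set
  Admissible i j = ((u∈U : inject₁ i ∈ U) → j ≡ parentOf i u∈U) × (inject₁ i ∉ U → OutsideEdge j)

  admissible? : ∀ i j → Dec (Admissible i j)
  admissible? i j with inject₁ i ∈? U
  ... | yes u∈U = map′ (λ e → (λ _ → e) , (λ u∉U → contradiction u∈U u∉U)) (λ a → proj₁ a u∈U)
                       (j ≟ parentOf i u∈U)
  ... | no  u∉U = map′ (λ o → (λ u∈U → contradiction u∈U u∉U) , (λ _ → o)) (λ a → proj₂ a u∉U)
                       (outsideEdge? j)

  Compatible : (Fin k → Fin m) → Set
  Compatible f = ∀ i → Admissible i (f i)

module Uniqueness {k m} (G : MultiGraph (suc k) m) {U : Subset (suc k)} {S : Subset m}
                  (tree : IsTree G U S) (r∈U : fromℕ k ∈ U) {f : Fin k → Fin m}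
                  (compatible : Compatibility.Compatible G tree r∈U f) where
  open Graph G
  open RootedTree G tree r∈U
  open Compatibility G tree r∈U
  open FunctionalGraph G f

  private
    variable
      v : Fin (suc k)

  next≡other-parent : ∀ i (u∈U : inject₁ i ∈ U) → next (inject₁ i) ≡ other (parentOf i u∈U) (inject₁ i)
  next≡other-parent i u∈U =
    ≡.trans (next-inject₁ i) (≡.cong (λ e → other e (inject₁ i)) (proj₁ (compatible i) u∈U))

  U⊆Uᶠ : U ⊆ Uᶠ
  U⊆Uᶠ = parent-induction (_∈ Uᶠ) r∈Uᶠ up
    where
      up : ∀ {v} (v∈U : v ∈ U) (v≢r : v ≢ fromℕ k) → other (parent v∈U v≢r) v ∈ Uᶠ → v ∈ Uᶠ
      up {v} v∈U v≢r x∈Uᶠ with lastView v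
      ... | last     = contradiction ≡.refl v≢r
      ... | inject i = next∈Uᶠ⁻ (≡.subst (_∈ Uᶠ) (≡.sym (next≡other-parent i v∈U)) x∈Uᶠ)

  never-reaches : v ∉ U → ∀ t → iterate next v t ≢ fromℕ k
  never-reaches v∉U zero    v≡r = v∉U (≡.subst (_∈ U) (≡.sym v≡r) r∈U)
  never-reaches {v} v∉U (suc t) eq with lastView v
  ... | last     = v∉U r∈U
  ... | inject i = never-reaches next∉U t eq
    where
      next∉U : other (f i) (inject₁ i) ∉ U
      next∉U with other-end (f i) (inject₁ i) | proj₂ (compatible i) v∉U
      ... | inj₁ ≡e₁ | e₁∉U , _ = e₁∉U ∘ ≡.subst (_∈ U) ≡e₁
      ... | inj₂ ≡e₂ | _ , e₂∉U = e₂∉U ∘ ≡.subst (_∈ U) ≡e₂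

  Uᶠ⊆U : Uᶠ ⊆ U
  Uᶠ⊆U {v} v∈Uᶠ with v ∈? U
  ... | yes v∈U = v∈U
  ... | no  v∉U = contradiction (∈Uᶠ⁻ v∈Uᶠ) (never-reaches v∉U (suc k))

  S⊆Sᶠ : S ⊆ Sᶠ
  S⊆Sᶠ j∈S with parent-onto j∈S
  ... | v , v∈U , v≢r , parent≡j with lastView v
  ...   | last     = contradiction ≡.refl v≢r
  ...   | inject i = ∈-subset⁺ treeEdge? (i , U⊆Uᶠ v∈U , ≡.trans (proj₁ (compatible i) v∈U) parent≡j)

  Sᶠ⊆S : Sᶠ ⊆ S
  Sᶠ⊆S j∈Sᶠ with ∈-subset⁻ treeEdge? j∈Sᶠ
  ... | i , u∈Uᶠ , ≡.refl = ≡.subst (_∈ S) (≡.sym (proj₁ (compatible i) (Uᶠ⊆U u∈Uᶠ)))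
                             (IsParentEdge.∈S (parent-isParentEdge (Uᶠ⊆U u∈Uᶠ) (inject₁≢root i)))

  compatible⇒functional : U ≡ Uᶠ × S ≡ Sᶠ
  compatible⇒functional = ⊆-antisym U⊆Uᶠ Uᶠ⊆U , ⊆-antisym S⊆Sᶠ Sᶠ⊆S

module FunctionalTree {k m} (G : MultiGraph (suc k) m) {f : Fin k → Fin m}
                      (incident : ∀ i → Incident G (f i) (inject₁ i))
                      (tree : IsTree G (FunctionalGraph.Uᶠ G f) (FunctionalGraph.Sᶠ G f))
                      (root∈Uᶠ : fromℕ k ∈ FunctionalGraph.Uᶠ G f) where
  open Graph G
  open FunctionalGraph G f
  open RootedTree G tree root∈Uᶠ
  open Compatibility G tree root∈Uᶠ

  private
    variable
      v a b : Fin (suc k)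
      j : Fin m

  iterate⇒Near : ∀ t → v ∈ Uᶠ → iterate next v t ≡ fromℕ k → Near t v
  iterate⇒Near zero    _   v≡r = v≡r
  iterate⇒Near (suc t) = via (lastView _)
    where
      via : LastView v → v ∈ Uᶠ → iterate next (next v) t ≡ fromℕ k → Near (suc t) v
      via last       _    _  = inj₁ ≡.refl
      via (inject i) u∈Uᶠ eq = inj₂ (f i , f∈Sᶠ incident u∈Uᶠ , incident i ,
                                     ≡.subst (Near t) (next-inject₁ i) (iterate⇒Near t (next∈Uᶠ u∈Uᶠ) eq))

  depth-step : j ∈ Sᶠ → Joins G j a b → depth a ≤ suc (depth b)
  depth-step j∈Sᶠ jn with ∈-subset⁻ treeEdge? j∈Sᶠ
  ... | i , u∈Uᶠ , ≡.refl with Joins-unique jn (Joins-next incident i)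
  ...   | inj₁ (≡.refl , ≡.refl) = ℕ.≤-reflexive (depth-next i u∈Uᶠ)
  ...   | inj₂ (≡.refl , ≡.refl) =
    ℕ.≤-trans (ℕ.n≤1+n _) (ℕ.≤-trans (ℕ.≤-reflexive (≡.sym (depth-next i u∈Uᶠ))) (ℕ.n≤1+n _))

  Near⇒depth≤ : ∀ s → Near s v → depth v ≤ s
  Near⇒depth≤ zero    v≡r        = depth-minimal 0 v≡r
  Near⇒depth≤ (suc s) (inj₁ v≡r) = ℕ.≤-trans (depth-minimal 0 v≡r) z≤n
  Near⇒depth≤ (suc s) (inj₂ (j , j∈Sᶠ , inc , near)) =
    ℕ.≤-trans (depth-step j∈Sᶠ (Incident⇒Joins-other inc)) (s≤s (Near⇒depth≤ s near))

  dist≡depth : v ∈ Uᶠ → dist v ≡ depth v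
  dist≡depth v∈Uᶠ = ℕ.≤-antisym
    (dist-minimal _ (iterate⇒Near _ v∈Uᶠ (depth-reaches v∈Uᶠ)))
    (Near⇒depth≤ _ (dist-near v∈Uᶠ))

  f≡parent : ∀ i (u∈Uᶠ : inject₁ i ∈ Uᶠ) → f i ≡ parentOf i u∈Uᶠ
  f≡parent i u∈Uᶠ = from-child (child-edge incident ∈S joins (ℕ.≤-trans (ℕ.n≤1+n _) up-is-higher))
    where
      open IsParentEdge (parent-isParentEdge u∈Uᶠ (inject₁≢root i))
      up-is-higher : suc (depth (other (parentOf i u∈Uᶠ) (inject₁ i))) ≤ depth (inject₁ i)
      up-is-higher =
        ℕ.≤-reflexive (≡.trans (≡.cong suc (≡.sym (dist≡depth other∈U))) (≡.trans dist≡ (dist≡depth u∈Uᶠ)))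
      from-child : (∃ λ i′ → parentOf i u∈Uᶠ ≡ f i′ × inject₁ i ≡ inject₁ i′) → f i ≡ parentOf i u∈Uᶠ
      from-child (i′ , parent≡f , u≡u′) =
        ≡.sym (≡.trans parent≡f (≡.cong f (≡.sym (inject₁-injective u≡u′))))

  outside : ∀ i → inject₁ i ∉ Uᶠ → OutsideEdge (f i)
  outside i u∉Uᶠ = Joins⇒ends {P = _∉ Uᶠ} (Joins-next incident i) u∉Uᶠ (u∉Uᶠ ∘ next∈Uᶠ⁻)

  functional-compatible : Compatible f
  functional-compatible i = f≡parent i , outside i

-- Expanding both sides

module DegreeProduct {c ℓ} (R : CommutativeRing c ℓ) {k m} (G : MultiGraph (suc k) m)
                  (y : Fin m → CommutativeRing.Carrier R) where
  open CommutativeRing R renaming (Carrier to C) hiding (zero)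
  open Weighted R
  open SemiringFold commutativeSemiring
  open Graph G
  open import Relation.Binary.Reasoning.Setoid setoid

  private
    r = fromℕ k

    when₀ when₁ : ∀ {P : Set ℓp} → Dec P → C → C
    when₀ = Additive.when
    when₁ = Multiplicative.when

    ∑ᶠ ∏ᶠ : ∀ {n} → (Fin n → C) → C
    ∑ᶠ = Additive.sum
    ∏ᶠ = Multiplicative.sum

  incidence : Fin k → Fin m → C
  incidence i j = when₀ (incident? G (inject₁ i) j) (y j)

  monomial : (Fin k → Fin m) → C
  monomial f = ∏ᶠ (λ i → incidence i (f i))

  degW-as-sum : ∀ v → degW G y v ≈ ∑ᶠ (λ j → when₀ (incident? G v j) (y j))
  degW-as-sum v = trans (Additive.fold-filter (incident? G v) y (allFin m))
                        (reflexive (Additive.fold-allFin (λ j → when₀ (incident? G v j) (y j))))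

  ∏degW-expansion : ∏ (map (λ i → degW G y (inject₁ i)) (allFin k)) ≈ ∑ (map monomial (functions k m))
  ∏degW-expansion = begin
    ∏ (map (λ i → degW G y (inject₁ i)) (allFin k))  ≡⟨ Multiplicative.fold-allFin (λ i → degW G y (inject₁ i)) ⟩
    ∏ᶠ (λ i → degW G y (inject₁ i))                  ≈⟨ Multiplicative.sum-cong-≋ (λ i → degW-as-sum (inject₁ i)) ⟩
    ∏ᶠ (λ i → ∑ᶠ (incidence i))                      ≈⟨ ∏∑-expand incidence ⟩
    ∑ (map monomial (functions k m))                  ∎

  module TreeTerm {U : Subset (suc k)} {S : Subset m} (tree : IsTree G U S) (r∈U : r ∈ U) where
    open RootedTree G tree r∈U
    open Compatibility G tree r∈U

    choice : Fin k → Fin m → C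
    choice i j = when₀ (incident? G (inject₁ i) j ×-dec admissible? i j) (y j)

    term : (Fin k → Fin m) → C
    term f = ∏ᶠ (λ i → choice i (f i))

    parentWeight : ∀ i → Dec (inject₁ i ∈ U) → C
    parentWeight i (yes u∈U) = y (parentOf i u∈U)
    parentWeight i (no _)    = 1#

    -- the product of these entries is τ(T) when read by columns, and the product of y over the
    -- parent edges when read by rows
    parentEntry : Fin k → Fin m → C
    parentEntry i j = when₁ (hasChild? j (inject₁ i)) (y j)

    parentEntry-row : ∀ i d → ∏ᶠ (parentEntry i) ≈ parentWeight i d
    parentEntry-row i (yes u∈U) =
      trans (Multiplicative.sum-point _ (parentOf i u∈U) off)
            (Multiplicative.when-accept (hasChild? _ (inject₁ i)) (u∈U , inject₁≢root i , ≡.refl))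
      where
        off : ∀ j → j ≢ parentOf i u∈U → parentEntry i j ≈ 1#
        off j j≢ = Multiplicative.when-reject (hasChild? j (inject₁ i)) (λ (_ , _ , ≡j) → j≢ (≡.sym ≡j))
    parentEntry-row i (no u∉U) =
      Multiplicative.sum-ε _ (λ j → Multiplicative.when-reject (hasChild? j (inject₁ i)) (u∉U ∘ proj₁))

    parentEntry-column : ∀ j → ∏ᶠ (λ i → parentEntry i j) ≈ when₁ (j ∈? S) (y j)
    parentEntry-column j with j ∈? S
    ... | no  j∉S = Multiplicative.sum-ε _ (λ i → Multiplicative.when-reject (hasChild? j (inject₁ i)) childless)
      where
        childless : ∀ {v} → ¬ HasChild j v
        childless (v∈U , v≢r , ≡j) = j∉S (≡.subst (_∈ S) ≡j (IsParentEdge.∈S (parent-isParentEdge v∈U v≢r)))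
    ... | yes j∈S = column-at (lastView _) (proj₂ (parent-onto j∈S))
      where
        column-at : ∀ {v} → LastView v → HasChild j v → ∏ᶠ (λ i → parentEntry i j) ≈ y j
        column-at last         (_ , r≢r , _) = contradiction ≡.refl r≢r
        column-at (inject i₀) child@(u₀∈U , u₀≢r , ≡j) =
          trans (Multiplicative.sum-point _ i₀ off) (Multiplicative.when-accept (hasChild? j (inject₁ i₀)) child)
          where
            off : ∀ i → i ≢ i₀ → parentEntry i j ≈ 1#
            off i i≢i₀ = Multiplicative.when-reject (hasChild? j (inject₁ i))
              (λ (u∈U , u≢r , ≡j′) → i≢i₀ (inject₁-injective (parent-injective u∈U u≢r u₀∈U u₀≢r (≡.trans ≡j′ (≡.sym ≡j)))))

    τT-as-product : τT G y S ≈ ∏ᶠ (λ i → parentWeight i (inject₁ i ∈? U))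
    τT-as-product = begin
      τT G y S                                         ≈⟨ Multiplicative.fold-filter (_∈? S) y (allFin m) ⟩
      ∏ (map (λ j → when₁ (j ∈? S) (y j)) (allFin m))  ≡⟨ Multiplicative.fold-allFin (λ j → when₁ (j ∈? S) (y j)) ⟩
      ∏ᶠ (λ j → when₁ (j ∈? S) (y j))                  ≈⟨ Multiplicative.sum-cong-≋ (λ j → sym (parentEntry-column j)) ⟩
      ∏ᶠ (λ j → ∏ᶠ (λ i → parentEntry i j))            ≈⟨ Multiplicative.∑-comm parentEntry ⟨
      ∏ᶠ (λ i → ∏ᶠ (parentEntry i))                    ≈⟨ Multiplicative.sum-cong-≋ (λ i → parentEntry-row i (inject₁ i ∈? U)) ⟩
      ∏ᶠ (λ i → parentWeight i (inject₁ i ∈? U))       ∎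

    outDegree : Fin (suc k) → C
    outDegree v = ∑ (map y (filter (incident? G v) (filter outsideEdge? (allFin m))))

    outsideWeight : ∀ i → Dec (inject₁ i ∈ U) → C
    outsideWeight i (yes _) = 1#
    outsideWeight i (no _)  = outDegree (inject₁ i)

    F-minus-as-product : F-minus G y U ≈ ∏ᶠ (λ i → outsideWeight i (inject₁ i ∈? U))
    F-minus-as-product = begin
      F-minus G y U
        ≈⟨ Multiplicative.fold-filter (λ v → ¬? (v ∈? U)) outDegree (allFin (suc k)) ⟩
      ∏ (map outside (allFin (suc k)))
        ≡⟨ Multiplicative.fold-allFin outside ⟩
      ∏ᶠ outside
        ≈⟨ Multiplicative.sum-init-last outside ⟩
      ∏ᶠ (outside ∘ inject₁) * outside r
        ≈⟨ *-cong (reflexive (Multiplicative.sum-cong-≗ (λ i → by-membership (inject₁ i ∈? U))))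
                  (Multiplicative.when-reject (¬? (r ∈? U)) (λ r∉U → r∉U r∈U)) ⟩
      ∏ᶠ (λ i → outsideWeight i (inject₁ i ∈? U)) * 1#
        ≈⟨ *-identityʳ _ ⟩
      ∏ᶠ (λ i → outsideWeight i (inject₁ i ∈? U))
        ∎
      where
        outside : Fin (suc k) → C
        outside v = when₁ (¬? (v ∈? U)) (outDegree v)
        by-membership : ∀ {i} (d : Dec (inject₁ i ∈ U)) → when₁ (¬? d) (outDegree (inject₁ i)) ≡ outsideWeight i d
        by-membership (yes _) = ≡.refl
        by-membership (no _)  = ≡.refl

    choice-row : ∀ i d → ∑ᶠ (choice i) ≈ parentWeight i d * outsideWeight i d
    choice-row i (yes u∈U) = begin
      ∑ᶠ (choice i) ≈⟨ Additive.sum-point (choice i) p off ⟩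
      choice i p    ≈⟨ Additive.when-accept (incident? G (inject₁ i) p ×-dec admissible? i p) (p-incident , p-admissible) ⟩
      y p           ≈⟨ *-identityʳ (y p) ⟨
      y p * 1#      ∎
      where
        p = parentOf i u∈U
        p-incident : Incident G p (inject₁ i)
        p-incident = Joins⇒Incident (IsParentEdge.joins (parent-isParentEdge u∈U (inject₁≢root i)))
        p-admissible : Admissible i p
        p-admissible = (λ _ → ≡.refl) , (λ u∉U → contradiction u∈U u∉U)
        off : ∀ j → j ≢ p → choice i j ≈ 0#
        off j j≢p = Additive.when-reject (incident? G (inject₁ i) j ×-dec admissible? i j) (λ (_ , adm) → j≢p (proj₁ adm u∈U))
    choice-row i (no u∉U) = begin
      ∑ᶠ (choice i)
        ≡⟨ Additive.sum-cong-≗ restrict ⟩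
      ∑ᶠ (λ j → when₀ (outsideEdge? j) (incidence i j))
        ≡⟨ Additive.fold-allFin (λ j → when₀ (outsideEdge? j) (incidence i j)) ⟨
      ∑ (map (λ j → when₀ (outsideEdge? j) (incidence i j)) (allFin m))
        ≈⟨ Additive.fold-filter outsideEdge? (incidence i) (allFin m) ⟨
      ∑ (map (incidence i) (filter outsideEdge? (allFin m)))
        ≈⟨ Additive.fold-filter (incident? G (inject₁ i)) y (filter outsideEdge? (allFin m)) ⟨
      outDegree (inject₁ i)
        ≈⟨ *-identityˡ _ ⟨
      1# * outDegree (inject₁ i)
        ∎
      where
        restrict : ∀ j → choice i j ≡ when₀ (outsideEdge? j) (incidence i j)
        restrict j = ≡.trans
          (Additive.when-cong (incident? G (inject₁ i) j ×-dec admissible? i j) (incident? G (inject₁ i) j ×-dec outsideEdge? j)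
             (λ (inc , adm) → inc , proj₂ adm u∉U) (λ (inc , out) → inc , (λ u∈U → contradiction u∈U u∉U) , (λ _ → out)))
          (Additive.when-× (incident? G (inject₁ i) j) (outsideEdge? j))

    τF-expansion : τT G y S * F-minus G y U ≈ ∑ (map term (functions k m))
    τF-expansion = begin
      τT G y S * F-minus G y U           ≈⟨ *-cong τT-as-product F-minus-as-product ⟩
      ∏ᶠ parentWeight′ * ∏ᶠ outsideWeight′ ≈⟨ Multiplicative.∑-distrib-+ parentWeight′ outsideWeight′ ⟨
      ∏ᶠ (λ i → parentWeight′ i * outsideWeight′ i) ≈⟨ Multiplicative.sum-cong-≋ (λ i → choice-row i (inject₁ i ∈? U)) ⟨
      ∏ᶠ (λ i → ∑ᶠ (choice i))           ≈⟨ ∏∑-expand choice ⟩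
      ∑ (map term (functions k m))       ∎
      where
        parentWeight′ outsideWeight′ : Fin k → C
        parentWeight′ i = parentWeight i (inject₁ i ∈? U)
        outsideWeight′ i = outsideWeight i (inject₁ i ∈? U)

    term-compatible : ∀ {f} → Compatible f → term f ≈ monomial f
    term-compatible {f} compatible = reflexive (Multiplicative.sum-cong-≗ λ i →
      Additive.when-cong (incident? G (inject₁ i) (f i) ×-dec admissible? i (f i)) (incident? G (inject₁ i) (f i))
        proj₁ (_, compatible i))

    term-incompatible : ∀ {f} i → ¬ Admissible i (f i) → term f ≈ 0#
    term-incompatible {f} i ¬adm = ∏-zero _ i (Additive.when-reject (incident? G (inject₁ i) (f i) ×-dec admissible? i (f i)) (¬adm ∘ proj₂))

    term-nonincident : ∀ {f} i → ¬ Incident G (f i) (inject₁ i) → term f ≈ 0#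
    term-nonincident {f} i ¬inc = ∏-zero _ i (Additive.when-reject (incident? G (inject₁ i) (f i) ×-dec admissible? i (f i)) (¬inc ∘ proj₁))

  pairs : List (Subset (suc k) × Subset m)
  pairs = cartesianProduct (allSubsets (suc k)) (allSubsets m)

  RootedSubtree : Subset (suc k) × Subset m → Set
  RootedSubtree (U , S) = IsTree G U S × r ∈ U

  subtreeTerm : ∀ US → Dec (RootedSubtree US) → (Fin k → Fin m) → C
  subtreeTerm (U , S) (yes (tree , r∈U)) f = TreeTerm.term tree r∈U f
  subtreeTerm _       (no _)             _ = 0#

  subtreeWeight : ∀ US → Dec (RootedSubtree US) → C
  subtreeWeight (U , S) (yes _) = τT G y S * F-minus G y U
  subtreeWeight _       (no _)  = 0#

  subtreeWeight-expansion : ∀ US d → subtreeWeight US d ≈ ∑ (map (subtreeTerm US d) (functions k m))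
  subtreeWeight-expansion (U , S) (yes (tree , r∈U)) = TreeTerm.τF-expansion tree r∈U
  subtreeWeight-expansion (U , S) (no _)             = sym (Additive.fold-map-ε (functions k m) (λ _ → refl))

  module _ (subtree? : ∀ US → Dec (RootedSubtree US)) (f : Fin k → Fin m) where
    open FunctionalGraph G f using (Uᶠ; Sᶠ; isTree; r∈Uᶠ)

    ∑subtreeTerm : C
    ∑subtreeTerm = ∑ (map (λ US → subtreeTerm US (subtree? US) f) pairs)

    ∑subtreeTerm-nonincident : ∀ i → ¬ Incident G (f i) (inject₁ i) → ∑subtreeTerm ≈ monomial f
    ∑subtreeTerm-nonincident i ¬inc = begin
      ∑subtreeTerm ≈⟨ Additive.fold-map-ε pairs (λ US → vanishes US (subtree? US)) ⟩
      0#           ≈⟨ ∏-zero _ i (Additive.when-reject (incident? G (inject₁ i) (f i)) ¬inc) ⟨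
      monomial f   ∎
      where
        vanishes : ∀ US d → subtreeTerm US d f ≈ 0#
        vanishes (U , S) (yes (tree , r∈U)) = TreeTerm.term-nonincident tree r∈U i ¬inc
        vanishes (U , S) (no _)             = refl

    subtreeTerm-elsewhere : ∀ US d → US ≢ (Uᶠ , Sᶠ) → subtreeTerm US d f ≈ 0#
    subtreeTerm-elsewhere (U , S) (no _)             _   = refl
    subtreeTerm-elsewhere (U , S) (yes (tree , r∈U)) US≢ with all? (λ i → Compatibility.admissible? G tree r∈U i (f i))
    ... | yes compatible = contradiction (≡.cong₂ _,_ (proj₁ functional) (proj₂ functional)) US≢
      where functional = Uniqueness.compatible⇒functional G tree r∈U compatible
    ... | no ¬compatible =
      uncurry (TreeTerm.term-incompatible tree r∈U) (¬∀⟶∃¬ k _ (λ i → Compatibility.admissible? G tree r∈U i (f i)) ¬compatible)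

    subtreeTerm-functional : (∀ i → Incident G (f i) (inject₁ i)) → ∀ d → subtreeTerm (Uᶠ , Sᶠ) d f ≈ monomial f
    subtreeTerm-functional incident (no ¬tree)            = contradiction (isTree incident , r∈Uᶠ) ¬tree
    subtreeTerm-functional incident (yes (tree , r∈Uᶠ′)) =
      TreeTerm.term-compatible tree r∈Uᶠ′ (FunctionalTree.functional-compatible G incident tree r∈Uᶠ′)

    -- (Uᶠ, Sᶠ) is the only rooted subtree whose expansion contains the monomial of f
    ∑subtreeTerm≈monomial : ∑subtreeTerm ≈ monomial f
    ∑subtreeTerm≈monomial with all? (λ i → incident? G (inject₁ i) (f i))
    ... | yes incident = trans (Additive.fold-pairs-point _ (Uᶠ , Sᶠ) (λ US → subtreeTerm-elsewhere US (subtree? US)))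
                               (subtreeTerm-functional incident (subtree? (Uᶠ , Sᶠ)))
    ... | no ¬incident = uncurry ∑subtreeTerm-nonincident (¬∀⟶∃¬ k _ (λ i → incident? G (inject₁ i) (f i)) ¬incident)

  F-minus-⊤ : F-minus G y ⊤ ≈ 1#
  F-minus-⊤ = trans (Multiplicative.fold-filter (λ v → ¬? (v ∈? ⊤)) _ (allFin (suc k)))
                    (Multiplicative.fold-map-ε (allFin (suc k)) (λ v → Multiplicative.when-reject (¬? (v ∈? ⊤)) (λ v∉⊤ → v∉⊤ ∈⊤)))

  isSpanning? : (U : Subset (suc k)) → Dec (U ≡ ⊤)
  isSpanning? U = ≡-dec Bool._≟_ U ⊤

  module RightHandSide (decST : ∀ S → Dec (IsSpanningTree G S)) (decNST : ∀ US → Dec (IsNST G r US)) where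

    rootedSubtree? : ∀ U S → Dec (U ≡ ⊤) → Dec (RootedSubtree (U , S))
    rootedSubtree? U S (yes ≡.refl) = map′ (_, ∈⊤) proj₁ (decST S)
    rootedSubtree? U S (no U≢⊤)     = map′ (λ (tree , r∈U , _) → tree , r∈U) (λ (tree , r∈U) → tree , r∈U , U≢⊤) (decNST (U , S))

    subtree? : ∀ US → Dec (RootedSubtree US)
    subtree? (U , S) = rootedSubtree? U S (isSpanning? U)

    spanning nonspanning : Subset (suc k) × Subset m → C
    spanning (U , S) = when₀ (isSpanning? U) (when₀ (decST S) (τT G y S))
    nonspanning (U , S) = when₀ (decNST (U , S)) (τT G y S * F-minus G y U)

    τG-as-pair-sum : τG G y decST ≈ ∑ (map spanning pairs)
    τG-as-pair-sum = begin
      τG G y decST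
        ≈⟨ Additive.fold-filter decST (τT G y) (allSubsets m) ⟩
      ∑ (map (λ S → when₀ (decST S) (τT G y S)) (allSubsets m))
        ≈⟨ Additive.fold-map-cong (allSubsets m) (λ S → Additive.when-accept (isSpanning? ⊤) ≡.refl) ⟨
      ∑ (map (λ S → spanning (⊤ , S)) (allSubsets m))
        ≈⟨ Additive.fold-allSubsets-point _ ⊤ (λ U U≢⊤ → Additive.fold-map-ε (allSubsets m)
             (λ S → Additive.when-reject (isSpanning? U) U≢⊤)) ⟨
      ∑ (map (λ U → ∑ (map (λ S → spanning (U , S)) (allSubsets m))) (allSubsets (suc k)))
        ≈⟨ Additive.fold-cartesianProductWith _,_ spanning (allSubsets (suc k)) (allSubsets m) ⟨
      ∑ (map spanning pairs)
        ∎

    spanning+nonspanning : ∀ US → spanning US + nonspanning US ≈ subtreeWeight US (subtree? US)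
    spanning+nonspanning (U , S) = split (isSpanning? U)
      where
        split : (d : Dec (U ≡ ⊤)) → when₀ d (when₀ (decST S) (τT G y S)) + nonspanning (U , S) ≈ subtreeWeight (U , S) (rootedSubtree? U S d)
        split (yes ≡.refl) with decST S
        ... | yes _ = trans (+-congˡ (Additive.when-reject (decNST (⊤ , S)) (λ (_ , _ , ⊤≢⊤) → ⊤≢⊤ ≡.refl)))
                            (trans (+-identityʳ _) (sym (trans (*-congˡ F-minus-⊤) (*-identityʳ _))))
        ... | no  _ = trans (+-identityˡ _) (Additive.when-reject (decNST (⊤ , S)) (λ (_ , _ , ⊤≢⊤) → ⊤≢⊤ ≡.refl))
        split (no U≢⊤) with decNST (U , S)
        ... | yes _ = +-identityˡ _
        ... | no  _ = +-identityˡ _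

    rhs-as-pair-sum : τG G y decST + NSTsum G y r decNST ≈ ∑ (map (λ US → subtreeWeight US (subtree? US)) pairs)
    rhs-as-pair-sum = begin
      τG G y decST + NSTsum G y r decNST
        ≈⟨ +-cong τG-as-pair-sum (Additive.fold-filter decNST _ pairs) ⟩
      ∑ (map spanning pairs) + ∑ (map nonspanning pairs)
        ≈⟨ Additive.fold-map-∙ spanning nonspanning pairs ⟨
      ∑ (map (λ US → spanning US + nonspanning US) pairs)
        ≈⟨ Additive.fold-map-cong pairs spanning+nonspanning ⟩
      ∑ (map (λ US → subtreeWeight US (subtree? US)) pairs)
        ∎

theorem3 : ∀ {c ℓ : Level} (R : CommutativeRing c ℓ) (k m : ℕ)
    (G : MultiGraph (suc k) m) → Loopless G → Connected G
    → (y : Fin m → CommutativeRing.Carrier R)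
    → (decST : ∀ S → Dec (IsSpanningTree G S))
    → (decNST : ∀ US → Dec (IsNST G (fromℕ k) US))
    → CommutativeRing._≈_ R
        (Weighted.∏ R (map (λ i → Weighted.degW R G y (inject₁ i)) (allFin k)))
        (CommutativeRing._+_ R (Weighted.τG R G y decST)
                                (Weighted.NSTsum R G y (fromℕ k) decNST))
theorem3 R k m G _ _ y decST decNST = begin
  ∏ (map (λ i → degW G y (inject₁ i)) (allFin k))
    ≈⟨ ∏degW-expansion ⟩
  ∑ (map monomial fs)
    ≈⟨ Additive.fold-map-cong fs (∑subtreeTerm≈monomial subtree?) ⟨
  ∑ (map (λ f → ∑ (map (λ US → subtreeTerm US (subtree? US) f) pairs)) fs)
    ≈⟨ Additive.fold-map-comm (λ f US → subtreeTerm US (subtree? US) f) fs pairs ⟩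
  ∑ (map (λ US → ∑ (map (subtreeTerm US (subtree? US)) fs)) pairs)
    ≈⟨ Additive.fold-map-cong pairs (λ US → subtreeWeight-expansion US (subtree? US)) ⟨
  ∑ (map (λ US → subtreeWeight US (subtree? US)) pairs)
    ≈⟨ rhs-as-pair-sum ⟨
  τG G y decST + NSTsum G y (fromℕ k) decNST
    ∎
  where
    open CommutativeRing R using (_+_; setoid)
    open Weighted R
    open SemiringFold (CommutativeRing.commutativeSemiring R) using (module Additive)
    open DegreeProduct R G y
    open RightHandSide decST decNST
    open import Relation.Binary.Reasoning.Setoid setoid
    fs = functions k m
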